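{- Let $r\ge 3$ and $k\ge 2$ be integers, let $H=(V,\mathcal{E})$ be an $r$-minimal hypergraph, and let $c$ be any $k$-coloring of $H$. For $v\in V$ define: $d_1^i(v)=|\{e\in\mathcal{E}(v): |c(e)|=2,\ c(e\setminus\{v\})=\{i\}\}|$ for $i\ne c(v)$, and $d_1(v)=\sum_{i\ne c(v)}d_1^i(v)$; $d_2(v)=|\{e\in\mathcal{E}(v): |c(e)|=1\}|$; $d_3(v)=|\{e\in\mathcal{E}(v): |c(e)|=2 \text{ and there exists } v'\in e, v'\ne v, \text{ with } |c(e\setminus\{v'\})|=1\}|$; $d_4(v)=|\mathcal{E}(v)|-(d_1(v)+d_2(v)+d_3(v))$; and let $D_i=\sum_{v\in V}d_i(v)$ for $i=1,2,3,4$. Then: (1) $D_1+D_2+D_3+D_4=\sum_{v\in V}|\mathcal{E}(v)|$; (2) $D_3\ge (r-1)D_1$; (3) if $c$ is a Nash equilibrium of the game in which all vertices are non-monochromatic seeking, then $D_1\ge (k-1)D_2$.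
   Context: A hypergraph is a pair $H=(V,\mathcal{E})$ with $V$ a finite set and $\mathcal{E}$ a collection of non-empty subsets of $V$; it is $r$-minimal if every hyperedge has at least $r$ elements. A $k$-coloring is a function $c:V\to[k]=\{1,\dots,k\}$; for $S\subseteq V$, $c(S)$ is the set of colors used on $S$. $\mathcal{E}(v)=\{e\in\mathcal{E}: v\in e\}$. A non-monochromatic seeking vertex $v$ has utility $u_v(c)=|\{e\in\mathcal{E}(v): |c(e)|>1\}|$. A coloring $c$ is a Nash equilibrium if no vertex $v$ can strictly increase $u_v$ by changing only its own color to some $i\in[k]$. -}

module Defs where

open import Data.Nat using (ℕ; zero; suc; _+_; _∸_; _≤_)
open import Data.Bool using (Bool; true; false; if_then_else_; _∧_)
open import Data.Fin using (Fin; _≟_)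
open import Data.Fin.Properties using (any?)
open import Data.Fin.Subset using (Subset; inside; outside; _∈_; ⁅_⁆; _-_; ∣_∣)
open import Data.Fin.Subset.Properties using (_∈?_)
open import Data.Vec using (tabulate)
open import Data.List using (List; length; filter; allFin; map)
open import Data.Nat.ListAction using (sum)
open import Data.List.Relation.Unary.All using (All)
open import Data.Product using (_×_; _,_; ∃)
open import Relation.Nullary using (Dec; yes; no; ¬_; does)
open import Relation.Nullary.Decidable using (_×-dec_; ¬?)
open import Relation.Binary.PropositionalEquality using (_≡_)
import Data.Nat as ℕ

record Hypergraph (n : ℕ) : Set where
  field
    edges : List (Subset n)
open Hypergraph public

RMinimal : ∀ {n} → ℕ → Hypergraph n → Set
RMinimal r H = All (λ e → r ≤ ∣ e ∣) (edges H)

Coloring : ℕ → ℕ → Set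
Coloring n k = Fin n → Fin k

colorsOf : ∀ {n k} → Coloring n k → Subset n → Subset k
colorsOf {n} c S =
  tabulate (λ j → does (any? (λ w → (w ∈? S) ×-dec (c w ≟ j))))

countL : ∀ {A : Set} {P : A → Set} → ((x : A) → Dec (P x)) → List A → ℕ
countL P? xs = length (filter P? xs)

deg : ∀ {n} → Hypergraph n → Fin n → ℕ
deg H v = countL (λ e → v ∈? e) (edges H)

sumFin : ∀ m → (Fin m → ℕ) → ℕ
sumFin m f = sum (map f (allFin m))

module _ {n k : ℕ} (H : Hypergraph n) (c : Coloring n k) where

  d1i : Fin n → Fin k → ℕ
  d1i v i = countL (λ e → (v ∈? e) ×-dec ((∣ colorsOf c e ∣ ℕ.≟ 2)
               ×-dec (Data.Vec.Properties.≡-dec Data.Bool._≟_ (colorsOf c (e - v)) ⁅ i ⁆)))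
               (edges H)
    where import Data.Vec.Properties
          import Data.Bool

  d1 : Fin n → ℕ
  d1 v = sumFin k (λ i → if does (i ≟ c v) then 0 else d1i v i)

  d2 : Fin n → ℕ
  d2 v = countL (λ e → (v ∈? e) ×-dec (∣ colorsOf c e ∣ ℕ.≟ 1)) (edges H)

  d3 : Fin n → ℕ
  d3 v = countL (λ e → (v ∈? e) ×-dec ((∣ colorsOf c e ∣ ℕ.≟ 2)
            ×-dec any? (λ v' → (v' ∈? e) ×-dec (¬? (v' ≟ v))
                                ×-dec (∣ colorsOf c (e - v') ∣ ℕ.≟ 1))))
            (edges H)

  -- d_4(v) = |E(v)| - (d_1(v) + d_2(v) + d_3(v))   (truncated subtraction on ℕ)
  d4 : Fin n → ℕ
  d4 v = deg H v ∸ (d1 v + d2 v + d3 v)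

  D1 D2 D3 D4 : ℕ
  D1 = sumFin n d1
  D2 = sumFin n d2
  D3 = sumFin n d3
  D4 = sumFin n d4

  sumDeg : ℕ
  sumDeg = sumFin n (deg H)

recolor : ∀ {n k} → Coloring n k → Fin n → Fin k → Coloring n k
recolor c v i w = if does (w ≟ v) then i else c w

-- utility of a non-monochromatic seeking vertex:
-- u_v(c) = |{e ∈ E(v) : |c(e)| > 1}|
utility : ∀ {n k} → Hypergraph n → Coloring n k → Fin n → ℕ
utility H c v = countL (λ e → (v ∈? e) ×-dec (2 ℕ.≤? ∣ colorsOf c e ∣)) (edges H)

NashEquilibrium : ∀ {n k} → Hypergraph n → Coloring n k → Set
NashEquilibrium {n} {k} H c =
  (v : Fin n) (i : Fin k) → ¬ (utility H c v ℕ.< utility H (recolor c v i) v)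

module Submission where

-- Double counting over incident pairs (v, e). Call v lonely in e with colour i when e is
-- bichromatic and e ∖ {v} is monochromatic of colour i. In a hyperedge with at least three
-- vertices at most one vertex is lonely, since a third vertex would carry both colours;
-- so the pairs counted by d₁, d₂, d₃ are disjoint (which is all (1) needs, D₄ being
-- defined by truncated subtraction), and an edge with a lonely vertex contributes one pair
-- to D₁ and its |e| − 1 ≥ r − 1 other vertices to D₃, giving (2). For (3), recolouring v
-- with i ≠ c(v) breaks every monochromatic edge at v and makes monochromatic only the edges
-- in which v is lonely with colour i; at a Nash equilibrium this gives d₂(v) ≤ d₁ⁱ(v), and
-- summing over the k − 1 colours i ≠ c(v) gives the claim.

open import Data.Nat using (ℕ; zero; suc; _+_; _*_; _∸_; _≤_; _≥_; z≤n; s≤s)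
import Data.Nat as ℕ
open import Data.Nat.Properties hiding (_≟_)
open import Data.Nat.ListAction using (sum)
open import Algebra.Properties.CommutativeSemigroup +-commutativeSemigroup using (interchange)
open import Data.Bool using (true; false; if_then_else_)
import Data.Bool as Bool
open import Data.Fin using (Fin; _≟_)
import Data.Fin as Fin
import Data.Fin.Properties as Finₚ
open import Data.Fin.Properties using (any?)
open import Data.Fin.Subset using (Subset; inside; outside; _∈_; _∉_; _⊆_; ⁅_⁆; _─_; _-_; ∣_∣; Nonempty)
open import Data.Fin.Subset.Properties
  using (_∈?_; nonempty?; Empty-unique; ∣⊥∣≡0; ∣⁅x⁆∣≡1; x∈⁅x⁆; x∈⁅y⁆⇒x≡y; x∉⁅y⁆⇒x≢y;
         x∈p∧x≢y⇒x∈p-y; p─q⊆p; ⊆-antisym; p⊆q⇒∣p∣≤∣q∣; x∈p⇒∣p-x∣<∣p∣)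
open import Data.List using (List; []; _∷_; map; allFin; filter; length)
open import Data.List.Properties using (map-tabulate)
open import Data.List.Relation.Unary.All using (All; []; _∷_)
import Data.List.Relation.Unary.All as All
open import Data.Vec using ([]; _∷_; here; there)
open import Data.Vec.Properties using (lookup∘tabulate; []=⇒lookup; lookup⇒[]=; ≡-dec)
open import Data.Product using (_×_; _,_; ∃; proj₁; proj₂)
open import Data.Empty using (⊥-elim)
open import Function using (_∘_; id; case_of_)
open import Relation.Nullary using (Dec; yes; no; ¬_; does; proof)
open import Relation.Nullary.Decidable using (dec-true; _×-dec_; ¬?)
open import Relation.Nullary.Reflects using (Reflects; invert)
open import Relation.Binary.PropositionalEquality
open import Defs

∑ : ∀ {A : Set} → List A → (A → ℕ) → ℕ
∑ xs f = sum (map f xs)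

module _ {A : Set} where

  ∑-cong : ∀ (xs : List A) {f g : A → ℕ} → (∀ x → f x ≡ g x) → ∑ xs f ≡ ∑ xs g
  ∑-cong []       f≡g = refl
  ∑-cong (x ∷ xs) f≡g = cong₂ _+_ (f≡g x) (∑-cong xs f≡g)

  ∑-mono : ∀ (xs : List A) {f g : A → ℕ} → (∀ x → f x ≤ g x) → ∑ xs f ≤ ∑ xs g
  ∑-mono []       f≤g = z≤n
  ∑-mono (x ∷ xs) f≤g = +-mono-≤ (f≤g x) (∑-mono xs f≤g)

  ∑-mono-All : ∀ {P : A → Set} {xs : List A} {f g : A → ℕ} →
               All P xs → (∀ x → P x → f x ≤ g x) → ∑ xs f ≤ ∑ xs g
  ∑-mono-All []         f≤g = z≤n
  ∑-mono-All (px ∷ pxs) f≤g = +-mono-≤ (f≤g _ px) (∑-mono-All pxs f≤g)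

  ∑-zero : ∀ (xs : List A) → ∑ xs (λ _ → 0) ≡ 0
  ∑-zero []       = refl
  ∑-zero (x ∷ xs) = ∑-zero xs

  ∑-distrib-+ : ∀ (xs : List A) (f g : A → ℕ) → ∑ xs (λ x → f x + g x) ≡ ∑ xs f + ∑ xs g
  ∑-distrib-+ []       f g = refl
  ∑-distrib-+ (x ∷ xs) f g =
    trans (cong (f x + g x +_) (∑-distrib-+ xs f g)) (interchange (f x) (g x) (∑ xs f) (∑ xs g))

  ∑-distribˡ-* : ∀ (xs : List A) (a : ℕ) (f : A → ℕ) → ∑ xs (λ x → a * f x) ≡ a * ∑ xs f
  ∑-distribˡ-* []       a f = sym (*-zeroʳ a)
  ∑-distribˡ-* (x ∷ xs) a f =
    trans (cong (a * f x +_) (∑-distribˡ-* xs a f)) (sym (*-distribˡ-+ a (f x) (∑ xs f)))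

∑-comm : ∀ {A B : Set} (xs : List A) (ys : List B) (f : A → B → ℕ) →
         ∑ xs (λ x → ∑ ys (f x)) ≡ ∑ ys (λ y → ∑ xs (λ x → f x y))
∑-comm []       ys f = sym (∑-zero ys)
∑-comm (x ∷ xs) ys f =
  trans (cong (∑ ys (f x) +_) (∑-comm xs ys f)) (sym (∑-distrib-+ ys (f x) (λ y → ∑ xs (λ x → f x y))))

𝟙 : ∀ {P : Set} → Dec P → ℕ
𝟙 d = if does d then 1 else 0

𝟙≤1 : ∀ {P : Set} (d : Dec P) → 𝟙 d ≤ 1
𝟙≤1 (yes _) = ≤-refl
𝟙≤1 (no _)  = z≤n

𝟙-yes : ∀ {P : Set} (d : Dec P) → P → 𝟙 d ≡ 1
𝟙-yes (yes _) _ = refl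
𝟙-yes (no ¬p) p = ⊥-elim (¬p p)

𝟙-no : ∀ {P : Set} (d : Dec P) → ¬ P → 𝟙 d ≡ 0
𝟙-no (yes p) ¬p = ⊥-elim (¬p p)
𝟙-no (no _)  _  = refl

𝟙-mono : ∀ {P Q : Set} (d : Dec P) (d′ : Dec Q) → (P → Q) → 𝟙 d ≤ 𝟙 d′
𝟙-mono (yes p) d′ P⇒Q = ≤-reflexive (sym (𝟙-yes d′ (P⇒Q p)))
𝟙-mono (no _)  d′ P⇒Q = z≤n

𝟙-exclusive : ∀ {P Q : Set} (d : Dec P) (d′ : Dec Q) → (P → ¬ Q) → 𝟙 d + 𝟙 d′ ≤ 1
𝟙-exclusive (yes p) d′ P⇒¬Q = ≤-reflexive (cong suc (𝟙-no d′ (P⇒¬Q p)))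
𝟙-exclusive (no _)  d′ P⇒¬Q = 𝟙≤1 d′

if-then-0≤ : ∀ b x → (if b then 0 else x) ≤ x
if-then-0≤ true  x = z≤n
if-then-0≤ false x = ≤-refl

if-does-then-0≡0 : ∀ {P : Set} (d : Dec P) {x} → (¬ P → x ≡ 0) → (if does d then 0 else x) ≡ 0
if-does-then-0≡0 (yes _) x≡0 = refl
if-does-then-0≡0 (no ¬p) x≡0 = x≡0 ¬p

if-does-then-0-mono : ∀ {P : Set} (d : Dec P) {x y} → (¬ P → x ≤ y) →
                      (if does d then 0 else x) ≤ (if does d then 0 else y)
if-does-then-0-mono (yes _) x≤y = z≤n
if-does-then-0-mono (no ¬p) x≤y = x≤y ¬p

length-filter≡∑𝟙 : ∀ {A : Set} {P : A → Set} (P? : ∀ x → Dec (P x)) (xs : List A) →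
                   length (filter P? xs) ≡ ∑ xs (λ x → 𝟙 (P? x))
length-filter≡∑𝟙 P? []       = refl
length-filter≡∑𝟙 P? (x ∷ xs) with P? x
... | yes _ = cong suc (length-filter≡∑𝟙 P? xs)
... | no _  = length-filter≡∑𝟙 P? xs

∑-allFin-suc : ∀ m (f : Fin (suc m) → ℕ) → ∑ (allFin (suc m)) f ≡ f Fin.zero + ∑ (allFin m) (f ∘ Fin.suc)
∑-allFin-suc m f =
  cong (λ l → f Fin.zero + sum l) (trans (map-tabulate Fin.suc f) (sym (map-tabulate id (f ∘ Fin.suc))))

∑-allFin-supported : ∀ {m} (j : Fin m) {f : Fin m → ℕ} → (∀ i → i ≢ j → f i ≡ 0) → ∑ (allFin m) f ≡ f j
∑-allFin-supported {suc m} Fin.zero {f} f≡0 = begin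
  ∑ (allFin (suc m)) f
    ≡⟨ ∑-allFin-suc m f ⟩
  f Fin.zero + ∑ (allFin m) (f ∘ Fin.suc)
    ≡⟨ cong (f Fin.zero +_) (trans (∑-cong (allFin m) (λ i → f≡0 (Fin.suc i) λ ())) (∑-zero (allFin m))) ⟩
  f Fin.zero + 0
    ≡⟨ +-identityʳ (f Fin.zero) ⟩
  f Fin.zero ∎
  where open ≡-Reasoning
∑-allFin-supported {suc m} (Fin.suc j) {f} f≡0 = begin
  ∑ (allFin (suc m)) f
    ≡⟨ ∑-allFin-suc m f ⟩
  f Fin.zero + ∑ (allFin m) (f ∘ Fin.suc)
    ≡⟨ cong₂ _+_ (f≡0 Fin.zero λ ()) (∑-allFin-supported j λ i i≢j → f≡0 (Fin.suc i) (i≢j ∘ Finₚ.suc-injective)) ⟩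
  f (Fin.suc j) ∎
  where open ≡-Reasoning

∑-allFin-const : ∀ m x → ∑ (allFin m) (λ _ → x) ≡ m * x
∑-allFin-const zero    x = refl
∑-allFin-const (suc m) x = trans (∑-allFin-suc m (λ _ → x)) (cong (x +_) (∑-allFin-const m x))

∑-allFin-except : ∀ {m} (j : Fin m) x → ∑ (allFin m) (λ i → if does (i ≟ j) then 0 else x) ≡ (m ∸ 1) * x
∑-allFin-except {suc m} Fin.zero x =
  trans (∑-allFin-suc m (λ i → if does (i ≟ Fin.zero) then 0 else x)) (∑-allFin-const m x)
∑-allFin-except {suc (suc m)} (Fin.suc j) x =
  trans (∑-allFin-suc (suc m) (λ i → if does (i ≟ Fin.suc j) then 0 else x)) (cong (x +_) (∑-allFin-except j x))

x∈p─q⇒x∉q : ∀ {n} (p q : Subset n) {x} → x ∈ p ─ q → x ∉ q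
x∈p─q⇒x∉q (_ ∷ p) (inside  ∷ q) {Fin.zero} ()
x∈p─q⇒x∉q (_ ∷ p) (outside ∷ q) here ()
x∈p─q⇒x∉q (_ ∷ p) (_       ∷ q) (there x∈p─q) (there x∈q) = x∈p─q⇒x∉q p q x∈p─q x∈q

x∈p-y⇒x∈p : ∀ {n} {p : Subset n} {x y} → x ∈ p - y → x ∈ p
x∈p-y⇒x∈p {p = p} {y = y} = p─q⊆p p ⁅ y ⁆

x∈p-y⇒x≢y : ∀ {n} {p : Subset n} {x y} → x ∈ p - y → x ≢ y
x∈p-y⇒x≢y {p = p} {y = y} x∈p-y = x∉⁅y⁆⇒x≢y (x∈p─q⇒x∉q p ⁅ y ⁆ x∈p-y)

∣p∣≤∣p─q∣+∣q∣ : ∀ {n} (p q : Subset n) → ∣ p ∣ ≤ ∣ p ─ q ∣ + ∣ q ∣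
∣p∣≤∣p─q∣+∣q∣ []            []            = z≤n
∣p∣≤∣p─q∣+∣q∣ (inside  ∷ p) (inside  ∷ q) = subst (suc ∣ p ∣ ≤_) (sym (+-suc _ _)) (s≤s (∣p∣≤∣p─q∣+∣q∣ p q))
∣p∣≤∣p─q∣+∣q∣ (outside ∷ p) (inside  ∷ q) = ≤-trans (∣p∣≤∣p─q∣+∣q∣ p q) (+-monoʳ-≤ ∣ p ─ q ∣ (n≤1+n ∣ q ∣))
∣p∣≤∣p─q∣+∣q∣ (inside  ∷ p) (outside ∷ q) = s≤s (∣p∣≤∣p─q∣+∣q∣ p q)
∣p∣≤∣p─q∣+∣q∣ (outside ∷ p) (outside ∷ q) = ∣p∣≤∣p─q∣+∣q∣ p q

∣p∣≤1+∣p-x∣ : ∀ {n} (p : Subset n) x → ∣ p ∣ ≤ suc ∣ p - x ∣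
∣p∣≤1+∣p-x∣ p x = subst (∣ p ∣ ≤_) (trans (cong (∣ p - x ∣ +_) (∣⁅x⁆∣≡1 x)) (+-comm _ 1)) (∣p∣≤∣p─q∣+∣q∣ p ⁅ x ⁆)

x∈p⇒∣p∣≡1+∣p-x∣ : ∀ {n} {p : Subset n} {x} → x ∈ p → ∣ p ∣ ≡ suc ∣ p - x ∣
x∈p⇒∣p∣≡1+∣p-x∣ {p = p} {x} x∈p = ≤-antisym (∣p∣≤1+∣p-x∣ p x) (x∈p⇒∣p-x∣<∣p∣ x∈p)

x∈p⇒1≤∣p∣ : ∀ {n} {p : Subset n} {x} → x ∈ p → 1 ≤ ∣ p ∣
x∈p⇒1≤∣p∣ {p = p} {x} x∈p =
  subst (_≤ ∣ p ∣) (∣⁅x⁆∣≡1 x) (p⊆q⇒∣p∣≤∣q∣ (λ y∈⁅x⁆ → subst (_∈ p) (sym (x∈⁅y⁆⇒x≡y x y∈⁅x⁆)) x∈p))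

1≤∣p∣⇒Nonempty : ∀ {n} (p : Subset n) → 1 ≤ ∣ p ∣ → Nonempty p
1≤∣p∣⇒Nonempty {n} p 1≤∣p∣ with nonempty? p
... | yes p≢∅ = p≢∅
... | no  p≡∅ = ⊥-elim (<⇒≢ 1≤∣p∣ (sym (trans (cong ∣_∣ (Empty-unique p≡∅)) (∣⊥∣≡0 n))))

∣p∣≤1⇒x∈p⇒y∈p⇒x≡y : ∀ {n} {p : Subset n} {x y} → ∣ p ∣ ≤ 1 → x ∈ p → y ∈ p → x ≡ y
∣p∣≤1⇒x∈p⇒y∈p⇒x≡y {p = p} {x} {y} ∣p∣≤1 x∈p y∈p with x ≟ y
... | yes x≡y = x≡y
... | no  x≢y = ⊥-elim (<-irrefl refl (begin-strict
  1                ≤⟨ x∈p⇒1≤∣p∣ (x∈p∧x≢y⇒x∈p-y y∈p (x≢y ∘ sym)) ⟩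
  ∣ p - x ∣        <⟨ x∈p⇒∣p-x∣<∣p∣ x∈p ⟩
  ∣ p ∣            ≤⟨ ∣p∣≤1 ⟩
  1                ∎))
  where open ≤-Reasoning

∈-avoiding : ∀ {n} {p : Subset n} → 2 ≤ ∣ p ∣ → ∀ a → ∃ λ w → w ∈ p × w ≢ a
∈-avoiding {p = p} 2≤∣p∣ a with 1≤∣p∣⇒Nonempty (p - a) (≤-pred (≤-trans 2≤∣p∣ (∣p∣≤1+∣p-x∣ p a)))
... | w , w∈p-a = w , x∈p-y⇒x∈p w∈p-a , x∈p-y⇒x≢y w∈p-a

∈-avoiding₂ : ∀ {n} {p : Subset n} → 3 ≤ ∣ p ∣ → ∀ a b → ∃ λ w → w ∈ p × w ≢ a × w ≢ b
∈-avoiding₂ {p = p} 3≤∣p∣ a b with ∈-avoiding {p = p - a} (≤-pred (≤-trans 3≤∣p∣ (∣p∣≤1+∣p-x∣ p a))) b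
... | w , w∈p-a , w≢b = w , x∈p-y⇒x∈p w∈p-a , x∈p-y⇒x≢y w∈p-a , w≢b

∣p∣≡∑𝟙∈ : ∀ {n} (p : Subset n) → ∣ p ∣ ≡ ∑ (allFin n) (λ x → 𝟙 (x ∈? p))
∣p∣≡∑𝟙∈ []              = refl
∣p∣≡∑𝟙∈ {suc n} (b ∷ p) = trans (split b) (sym (∑-allFin-suc n (λ x → 𝟙 (x ∈? b ∷ p))))
  where
  split : ∀ b → ∣ b ∷ p ∣ ≡ 𝟙 (Fin.zero ∈? b ∷ p) + ∑ (allFin n) (λ x → 𝟙 (x ∈? p))
  split inside  = cong suc (∣p∣≡∑𝟙∈ p)
  split outside = ∣p∣≡∑𝟙∈ p

module _ {n k : ℕ} (c : Coloring n k) where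

  ∈-colorsOf : ∀ {S w} → w ∈ S → c w ∈ colorsOf c S
  ∈-colorsOf {S} {w} w∈S =
    lookup⇒[]= (c w) (colorsOf c S) (trans (lookup∘tabulate _ (c w)) (dec-true (any? _) (w , w∈S , refl)))

  colorsOf-∈ : ∀ {S j} → j ∈ colorsOf c S → ∃ λ w → w ∈ S × c w ≡ j
  colorsOf-∈ {S} {j} j∈cS =
    invert (subst (Reflects _) (trans (sym (lookup∘tabulate _ j)) ([]=⇒lookup j∈cS)) (proof (any? _)))

  ∈-colorsOf⇒≡ : ∀ {S i w} → colorsOf c S ≡ ⁅ i ⁆ → w ∈ S → c w ≡ i
  ∈-colorsOf⇒≡ {i = i} cS≡⁅i⁆ w∈S = x∈⁅y⁆⇒x≡y i (subst (_ ∈_) cS≡⁅i⁆ (∈-colorsOf w∈S))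

  ∣colorsOf∣≤1⇒≡ : ∀ {S u w} → ∣ colorsOf c S ∣ ≤ 1 → u ∈ S → w ∈ S → c u ≡ c w
  ∣colorsOf∣≤1⇒≡ ∣cS∣≤1 u∈S w∈S = ∣p∣≤1⇒x∈p⇒y∈p⇒x≡y ∣cS∣≤1 (∈-colorsOf u∈S) (∈-colorsOf w∈S)

  colorsOf≡⁅i⁆ : ∀ {S i w} → (∀ {u} → u ∈ S → c u ≡ i) → w ∈ S → colorsOf c S ≡ ⁅ i ⁆
  colorsOf≡⁅i⁆ {S} {i} {w} S≡i w∈S = ⊆-antisym
    (λ j∈cS → let (u , u∈S , cu≡j) = colorsOf-∈ j∈cS in subst (_∈ ⁅ i ⁆) (trans (sym (S≡i u∈S)) cu≡j) (x∈⁅x⁆ i))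
    (λ j∈⁅i⁆ → subst (_∈ colorsOf c S) (trans (S≡i w∈S) (sym (x∈⁅y⁆⇒x≡y i j∈⁅i⁆))) (∈-colorsOf w∈S))

  colorsOf-─ : ∀ S v → colorsOf c S - c v ⊆ colorsOf c (S - v)
  colorsOf-─ S v j∈ with colorsOf-∈ (x∈p-y⇒x∈p j∈)
  ... | u , u∈S , refl = ∈-colorsOf (x∈p∧x≢y⇒x∈p-y u∈S (x∈p-y⇒x≢y j∈ ∘ cong c))

module _ {n k : ℕ} (c : Coloring n k) where

  -- The deciders lonely?, monochromatic? and lonelyElsewhere? are literally those used in
  -- Defs for d1i, d2 and d3, so these counts unfold to counts of the predicates below.
  Lonely : Subset n → Fin n → Fin k → Set
  Lonely e v i = v ∈ e × ∣ colorsOf c e ∣ ≡ 2 × colorsOf c (e - v) ≡ ⁅ i ⁆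

  lonely? : ∀ e v i → Dec (Lonely e v i)
  lonely? e v i = (v ∈? e) ×-dec ((∣ colorsOf c e ∣ ℕ.≟ 2) ×-dec (≡-dec Bool._≟_ (colorsOf c (e - v)) ⁅ i ⁆))

  lonelyCount : Fin n → Subset n → ℕ
  lonelyCount v e = ∑ (allFin k) (λ i → if does (i ≟ c v) then 0 else 𝟙 (lonely? e v i))

  monochromatic? : ∀ v e → Dec (v ∈ e × ∣ colorsOf c e ∣ ≡ 1)
  monochromatic? v e = (v ∈? e) ×-dec (∣ colorsOf c e ∣ ℕ.≟ 1)

  LonelyElsewhere : Fin n → Subset n → Set
  LonelyElsewhere v e =
    v ∈ e × ∣ colorsOf c e ∣ ≡ 2 × ∃ λ v′ → v′ ∈ e × v′ ≢ v × ∣ colorsOf c (e - v′) ∣ ≡ 1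

  lonelyElsewhere? : ∀ v e → Dec (LonelyElsewhere v e)
  lonelyElsewhere? v e = (v ∈? e) ×-dec ((∣ colorsOf c e ∣ ℕ.≟ 2)
    ×-dec any? (λ v′ → (v′ ∈? e) ×-dec (¬? (v′ ≟ v)) ×-dec (∣ colorsOf c (e - v′) ∣ ℕ.≟ 1)))

  lonelyCount≡0 : ∀ {v e} → (∀ i → i ≢ c v → ¬ Lonely e v i) → lonelyCount v e ≡ 0
  lonelyCount≡0 {v} {e} notLonely = trans (∑-cong (allFin k) term≡0) (∑-zero (allFin k))
    where
    term≡0 : ∀ i → (if does (i ≟ c v) then 0 else 𝟙 (lonely? e v i)) ≡ 0
    term≡0 i = if-does-then-0≡0 (i ≟ c v) (λ i≢cv → 𝟙-no (lonely? e v i) (notLonely i i≢cv))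

  lonelyCount≤1 : ∀ {v e i₀} → Lonely e v i₀ → lonelyCount v e ≤ 1
  lonelyCount≤1 {v} {e} {i₀} (_ , _ , ce-v≡⁅i₀⁆) = begin
    lonelyCount v e                                              ≡⟨ ∑-allFin-supported i₀ term≡0 ⟩
    (if does (i₀ ≟ c v) then 0 else 𝟙 (lonely? e v i₀))        ≤⟨ if-then-0≤ (does (i₀ ≟ c v)) _ ⟩
    𝟙 (lonely? e v i₀)                                           ≤⟨ 𝟙≤1 (lonely? e v i₀) ⟩
    1                                                            ∎
    where
    open ≤-Reasoning
    term≡0 : ∀ i → i ≢ i₀ → (if does (i ≟ c v) then 0 else 𝟙 (lonely? e v i)) ≡ 0
    term≡0 i i≢i₀ = if-does-then-0≡0 (i ≟ c v) (λ _ → 𝟙-no (lonely? e v i)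
      λ (_ , _ , ce-v≡⁅i⁆) → i≢i₀ (x∈⁅y⁆⇒x≡y i₀ (subst (i ∈_) (trans (sym ce-v≡⁅i⁆) ce-v≡⁅i₀⁆) (x∈⁅x⁆ i))))

  module _ {e : Subset n} (3≤∣e∣ : 3 ≤ ∣ e ∣) where

    lonely-vertex-unique : ∀ {v i v′} → v ∈ e → i ≢ c v → colorsOf c (e - v) ≡ ⁅ i ⁆ →
                           v′ ∈ e → v′ ≢ v → ∣ colorsOf c (e - v′) ∣ ≢ 1
    lonely-vertex-unique {v} {i} {v′} v∈e i≢cv ce-v≡⁅i⁆ v′∈e v′≢v ∣ce-v′∣≡1 with ∈-avoiding₂ 3≤∣e∣ v v′
    ... | w , w∈e , w≢v , w≢v′ = i≢cv (trans (sym cw≡i) cw≡cv)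
      where
      cw≡i : c w ≡ i
      cw≡i = ∈-colorsOf⇒≡ c ce-v≡⁅i⁆ (x∈p∧x≢y⇒x∈p-y w∈e w≢v)
      cw≡cv : c w ≡ c v
      cw≡cv = ∣colorsOf∣≤1⇒≡ c (≤-reflexive ∣ce-v′∣≡1) (x∈p∧x≢y⇒x∈p-y w∈e w≢v′) (x∈p∧x≢y⇒x∈p-y v∈e (v′≢v ∘ sym))

    lonely-partition : ∀ v → lonelyCount v e + 𝟙 (monochromatic? v e) + 𝟙 (lonelyElsewhere? v e) ≤ 𝟙 (v ∈? e)
    lonely-partition v = by-membership (v ∈? e)
      where
      LHS : ℕ
      LHS = lonelyCount v e + 𝟙 (monochromatic? v e) + 𝟙 (lonelyElsewhere? v e)

      ≡2⇒≢1 : ∣ colorsOf c e ∣ ≡ 2 → ∣ colorsOf c e ∣ ≢ 1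
      ≡2⇒≢1 ∣ce∣≡2 ∣ce∣≡1 = case trans (sym ∣ce∣≡1) ∣ce∣≡2 of λ ()

      by-lonely : v ∈ e → Dec (∃ λ i → i ≢ c v × Lonely e v i) → LHS ≤ 1
      by-lonely v∈e (yes (i , i≢cv , L@(_ , ∣ce∣≡2 , ce-v≡⁅i⁆))) =
        +-mono-≤ (+-mono-≤ (lonelyCount≤1 L) (≤-reflexive (𝟙-no (monochromatic? v e) (≡2⇒≢1 ∣ce∣≡2 ∘ proj₂))))
                 (≤-reflexive (𝟙-no (lonelyElsewhere? v e)
                    λ (_ , _ , _ , v′∈e , v′≢v , ∣ce-v′∣≡1) →
                      lonely-vertex-unique v∈e i≢cv ce-v≡⁅i⁆ v′∈e v′≢v ∣ce-v′∣≡1))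
      by-lonely v∈e (no notLonely) =
        subst (_≤ 1) (cong (λ x → x + 𝟙 (monochromatic? v e) + 𝟙 (lonelyElsewhere? v e))
                           (sym (lonelyCount≡0 λ i i≢cv L → notLonely (i , i≢cv , L))))
          (𝟙-exclusive (monochromatic? v e) (lonelyElsewhere? v e)
             λ (_ , ∣ce∣≡1) (_ , ∣ce∣≡2 , _) → ≡2⇒≢1 ∣ce∣≡2 ∣ce∣≡1)

      by-membership : Dec (v ∈ e) → LHS ≤ 𝟙 (v ∈? e)
      by-membership (yes v∈e) = subst (LHS ≤_) (sym (𝟙-yes (v ∈? e) v∈e))
                                  (by-lonely v∈e (any? (λ i → ¬? (i ≟ c v) ×-dec lonely? e v i)))
      by-membership (no v∉e) = ≤-trans (≤-reflexive LHS≡0) z≤n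
        where
        LHS≡0 : LHS ≡ 0
        LHS≡0 = cong₂ _+_ (cong₂ _+_ (lonelyCount≡0 (λ _ _ → v∉e ∘ proj₁))
                                      (𝟙-no (monochromatic? v e) (v∉e ∘ proj₁)))
                           (𝟙-no (lonelyElsewhere? v e) (v∉e ∘ proj₁))

    lonely-edge-bound : ∀ {r} → r ≤ ∣ e ∣ →
      (r ∸ 1) * ∑ (allFin n) (λ v → lonelyCount v e) ≤ ∑ (allFin n) (λ v → 𝟙 (lonelyElsewhere? v e))
    lonely-edge-bound {r} r≤∣e∣ with any? (λ v → any? (λ i → ¬? (i ≟ c v) ×-dec lonely? e v i))
    ... | no noneLonely = ≤-trans (≤-reflexive (trans (cong ((r ∸ 1) *_) ∑≡0) (*-zeroʳ (r ∸ 1)))) z≤n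
      where
      ∑≡0 : ∑ (allFin n) (λ v → lonelyCount v e) ≡ 0
      ∑≡0 = trans (∑-cong (allFin n) (λ v → lonelyCount≡0 λ i i≢cv L → noneLonely (v , i , i≢cv , L)))
                  (∑-zero (allFin n))
    ... | yes (v₀ , i₀ , _ , L₀@(v₀∈e , ∣ce∣≡2 , ce-v₀≡⁅i₀⁆)) = begin
      (r ∸ 1) * ∑ (allFin n) (λ v → lonelyCount v e)    ≡⟨ cong ((r ∸ 1) *_) (∑-allFin-supported v₀ others≡0) ⟩
      (r ∸ 1) * lonelyCount v₀ e                        ≤⟨ *-monoʳ-≤ (r ∸ 1) (lonelyCount≤1 L₀) ⟩
      (r ∸ 1) * 1                                       ≡⟨ *-identityʳ (r ∸ 1) ⟩
      r ∸ 1                                             ≤⟨ ∸-monoˡ-≤ 1 r≤∣e∣ ⟩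
      ∣ e ∣ ∸ 1                                         ≡⟨ cong (_∸ 1) (x∈p⇒∣p∣≡1+∣p-x∣ v₀∈e) ⟩
      ∣ e - v₀ ∣                                        ≡⟨ ∣p∣≡∑𝟙∈ (e - v₀) ⟩
      ∑ (allFin n) (λ w → 𝟙 (w ∈? e - v₀))
        ≤⟨ ∑-mono (allFin n) (λ w → 𝟙-mono (w ∈? e - v₀) (lonelyElsewhere? w e) lonelyElsewhere) ⟩
      ∑ (allFin n) (λ v → 𝟙 (lonelyElsewhere? v e))     ∎
      where
      open ≤-Reasoning
      ∣ce-v₀∣≡1 : ∣ colorsOf c (e - v₀) ∣ ≡ 1
      ∣ce-v₀∣≡1 = trans (cong ∣_∣ ce-v₀≡⁅i₀⁆) (∣⁅x⁆∣≡1 i₀)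
      others≡0 : ∀ v → v ≢ v₀ → lonelyCount v e ≡ 0
      others≡0 v v≢v₀ = lonelyCount≡0 λ i i≢cv (v∈e , _ , ce-v≡⁅i⁆) →
        lonely-vertex-unique v∈e i≢cv ce-v≡⁅i⁆ v₀∈e (v≢v₀ ∘ sym) ∣ce-v₀∣≡1
      lonelyElsewhere : ∀ {w} → w ∈ e - v₀ → LonelyElsewhere w e
      lonelyElsewhere w∈e-v₀ = x∈p-y⇒x∈p w∈e-v₀ , ∣ce∣≡2 , v₀ , v₀∈e , x∈p-y⇒x≢y w∈e-v₀ ∘ sym , ∣ce-v₀∣≡1

nonmonochromatic? : ∀ {n k} (c : Coloring n k) v e → Dec (v ∈ e × 2 ≤ ∣ colorsOf c e ∣)
nonmonochromatic? c v e = (v ∈? e) ×-dec (2 ℕ.≤? ∣ colorsOf c e ∣)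

module _ {n k : ℕ} (c : Coloring n k) (v : Fin n) (i : Fin k) where

  recolor-self : recolor c v i v ≡ i
  recolor-self with v ≟ v
  ... | yes _   = refl
  ... | no v≢v = ⊥-elim (v≢v refl)

  recolor-other : ∀ {u} → u ≢ v → recolor c v i u ≡ c u
  recolor-other {u} u≢v with u ≟ v
  ... | yes u≡v = ⊥-elim (u≢v u≡v)
  ... | no _    = refl

  recolor-monochromatic⇒Lonely : ∀ {e} → 2 ≤ ∣ e ∣ → v ∈ e → i ≢ c v →
                                 ∣ colorsOf (recolor c v i) e ∣ ≤ 1 → Lonely c e v i
  recolor-monochromatic⇒Lonely {e} 2≤∣e∣ v∈e i≢cv ∣c′e∣≤1 with ∈-avoiding 2≤∣e∣ v
  ... | w , w∈e , w≢v = v∈e , ∣ce∣≡2 , ce-v≡⁅i⁆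
    where
    others-i : ∀ {u} → u ∈ e - v → c u ≡ i
    others-i {u} u∈e-v = begin
      c u                  ≡⟨ sym (recolor-other (x∈p-y⇒x≢y u∈e-v)) ⟩
      recolor c v i u      ≡⟨ ∣colorsOf∣≤1⇒≡ (recolor c v i) ∣c′e∣≤1 (x∈p-y⇒x∈p u∈e-v) v∈e ⟩
      recolor c v i v      ≡⟨ recolor-self ⟩
      i                    ∎
      where open ≡-Reasoning
    w∈e-v : w ∈ e - v
    w∈e-v = x∈p∧x≢y⇒x∈p-y w∈e w≢v
    ce-v≡⁅i⁆ : colorsOf c (e - v) ≡ ⁅ i ⁆
    ce-v≡⁅i⁆ = colorsOf≡⁅i⁆ c others-i w∈e-v
    ∣ce-cv∣≡1 : ∣ colorsOf c e - c v ∣ ≡ 1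
    ∣ce-cv∣≡1 = ≤-antisym
      (subst (∣ colorsOf c e - c v ∣ ≤_) (trans (cong ∣_∣ ce-v≡⁅i⁆) (∣⁅x⁆∣≡1 i)) (p⊆q⇒∣p∣≤∣q∣ (colorsOf-─ c e v)))
      (x∈p⇒1≤∣p∣ (x∈p∧x≢y⇒x∈p-y (subst (_∈ colorsOf c e) (others-i w∈e-v) (∈-colorsOf c w∈e)) i≢cv))
    ∣ce∣≡2 : ∣ colorsOf c e ∣ ≡ 2
    ∣ce∣≡2 = trans (x∈p⇒∣p∣≡1+∣p-x∣ (∈-colorsOf c v∈e)) (cong suc ∣ce-cv∣≡1)

  recolor-gain : ∀ {e} → 2 ≤ ∣ e ∣ → i ≢ c v →
    𝟙 (monochromatic? c v e) + 𝟙 (nonmonochromatic? c v e)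
      ≤ 𝟙 (lonely? c e v i) + 𝟙 (nonmonochromatic? (recolor c v i) v e)
  recolor-gain {e} 2≤∣e∣ i≢cv = by-membership (v ∈? e)
    where
    by-recolored : v ∈ e → Dec (2 ≤ ∣ colorsOf (recolor c v i) e ∣) →
                   1 ≤ 𝟙 (lonely? c e v i) + 𝟙 (nonmonochromatic? (recolor c v i) v e)
    by-recolored v∈e (yes 2≤∣c′e∣) =
      ≤-trans (≤-reflexive (sym (𝟙-yes (nonmonochromatic? (recolor c v i) v e) (v∈e , 2≤∣c′e∣)))) (m≤n+m _ _)
    by-recolored v∈e (no 2≰∣c′e∣) =
      ≤-trans (≤-reflexive (sym (𝟙-yes (lonely? c e v i)
                 (recolor-monochromatic⇒Lonely 2≤∣e∣ v∈e i≢cv (≤-pred (≰⇒> 2≰∣c′e∣))))))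
              (m≤m+n _ _)

    by-membership : Dec (v ∈ e) →
      𝟙 (monochromatic? c v e) + 𝟙 (nonmonochromatic? c v e)
        ≤ 𝟙 (lonely? c e v i) + 𝟙 (nonmonochromatic? (recolor c v i) v e)
    by-membership (yes v∈e) =
      ≤-trans (𝟙-exclusive (monochromatic? c v e) (nonmonochromatic? c v e)
                 λ (_ , ∣ce∣≡1) (_ , 2≤∣ce∣) → case subst (2 ≤_) ∣ce∣≡1 2≤∣ce∣ of λ { (s≤s ()) })
              (by-recolored v∈e (2 ℕ.≤? ∣ colorsOf (recolor c v i) e ∣))
    by-membership (no v∉e) =
      ≤-trans (≤-reflexive (cong₂ _+_ (𝟙-no (monochromatic? c v e) (v∉e ∘ proj₁))
                                      (𝟙-no (nonmonochromatic? c v e) (v∉e ∘ proj₁))))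
              z≤n

module _ {n k : ℕ} (H : Hypergraph n) (c : Coloring n k) where

  d1≡∑lonelyCount : ∀ v → d1 H c v ≡ ∑ (edges H) (lonelyCount c v)
  d1≡∑lonelyCount v = trans (∑-cong (allFin k) per-colour) (∑-comm (allFin k) (edges H) _)
    where
    per-colour : ∀ i → (if does (i ≟ c v) then 0 else d1i H c v i)
                     ≡ ∑ (edges H) (λ e → if does (i ≟ c v) then 0 else 𝟙 (lonely? c e v i))
    per-colour i with i ≟ c v
    ... | yes _ = sym (∑-zero (edges H))
    ... | no  _ = length-filter≡∑𝟙 (λ e → lonely? c e v i) (edges H)

  d1+d2+d3≤deg : RMinimal 3 H → ∀ v → d1 H c v + d2 H c v + d3 H c v ≤ deg H v
  d1+d2+d3≤deg 3-minimal v = begin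
    d1 H c v + d2 H c v + d3 H c v
      ≡⟨ cong₂ _+_ (cong₂ _+_ (d1≡∑lonelyCount v) (length-filter≡∑𝟙 (monochromatic? c v) (edges H)))
                   (length-filter≡∑𝟙 (lonelyElsewhere? c v) (edges H)) ⟩
    ∑ (edges H) (lonelyCount c v) + ∑ (edges H) (𝟙 ∘ monochromatic? c v) + ∑ (edges H) (𝟙 ∘ lonelyElsewhere? c v)
      ≡⟨ sym (trans (∑-distrib-+ (edges H) _ _)
                    (cong (_+ ∑ (edges H) (𝟙 ∘ lonelyElsewhere? c v)) (∑-distrib-+ (edges H) _ _))) ⟩
    ∑ (edges H) (λ e → lonelyCount c v e + 𝟙 (monochromatic? c v e) + 𝟙 (lonelyElsewhere? c v e))
      ≤⟨ ∑-mono-All 3-minimal (λ e 3≤∣e∣ → lonely-partition c 3≤∣e∣ v) ⟩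
    ∑ (edges H) (λ e → 𝟙 (v ∈? e))
      ≡⟨ sym (length-filter≡∑𝟙 (v ∈?_) (edges H)) ⟩
    deg H v ∎
    where open ≤-Reasoning

  D1+D2+D3+D4≡sumDeg : RMinimal 3 H → D1 H c + D2 H c + D3 H c + D4 H c ≡ sumDeg H c
  D1+D2+D3+D4≡sumDeg 3-minimal = begin
    D1 H c + D2 H c + D3 H c + D4 H c
      ≡⟨ sym (trans (∑-distrib-+ V (λ v → d1 H c v + d2 H c v + d3 H c v) (d4 H c))
                    (cong (_+ D4 H c) (trans (∑-distrib-+ V _ (d3 H c))
                                             (cong (_+ D3 H c) (∑-distrib-+ V (d1 H c) (d2 H c)))))) ⟩
    ∑ V (λ v → d1 H c v + d2 H c v + d3 H c v + d4 H c v)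
      ≡⟨ ∑-cong V (λ v → m+[n∸m]≡n (d1+d2+d3≤deg 3-minimal v)) ⟩
    sumDeg H c ∎
    where
    open ≡-Reasoning
    V : List (Fin n)
    V = allFin n

  D3≥[r-1]D1 : ∀ {r} → 3 ≤ r → RMinimal r H → (r ∸ 1) * D1 H c ≤ D3 H c
  D3≥[r-1]D1 {r} 3≤r r-minimal = begin
    (r ∸ 1) * D1 H c
      ≡⟨ cong ((r ∸ 1) *_) (trans (∑-cong V d1≡∑lonelyCount) (∑-comm V (edges H) (lonelyCount c))) ⟩
    (r ∸ 1) * ∑ (edges H) (λ e → ∑ V (λ v → lonelyCount c v e))
      ≡⟨ sym (∑-distribˡ-* (edges H) (r ∸ 1) _) ⟩
    ∑ (edges H) (λ e → (r ∸ 1) * ∑ V (λ v → lonelyCount c v e))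
      ≤⟨ ∑-mono-All r-minimal (λ e r≤∣e∣ → lonely-edge-bound c (≤-trans 3≤r r≤∣e∣) r≤∣e∣) ⟩
    ∑ (edges H) (λ e → ∑ V (λ v → 𝟙 (lonelyElsewhere? c v e)))
      ≡⟨ sym (trans (∑-cong V (λ v → length-filter≡∑𝟙 (lonelyElsewhere? c v) (edges H)))
                    (∑-comm V (edges H) (λ v e → 𝟙 (lonelyElsewhere? c v e)))) ⟩
    D3 H c ∎
    where
    open ≤-Reasoning
    V : List (Fin n)
    V = allFin n

  NashEquilibrium⇒D1≥[k-1]D2 : RMinimal 2 H → NashEquilibrium H c → (k ∸ 1) * D2 H c ≤ D1 H c
  NashEquilibrium⇒D1≥[k-1]D2 2-minimal nash = begin
    (k ∸ 1) * D2 H c                   ≡⟨ sym (∑-distribˡ-* (allFin n) (k ∸ 1) (d2 H c)) ⟩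
    ∑ (allFin n) (λ v → (k ∸ 1) * d2 H c v) ≤⟨ ∑-mono (allFin n) d1≥[k-1]d2 ⟩
    D1 H c                             ∎
    where
    open ≤-Reasoning
    d2≤d1i : ∀ v i → i ≢ c v → d2 H c v ≤ d1i H c v i
    d2≤d1i v i i≢cv = +-cancelˡ-≤ (utility H c v) _ _ (begin
      utility H c v + d2 H c v
        ≡⟨ trans (+-comm (utility H c v) _)
                 (cong₂ _+_ (length-filter≡∑𝟙 (monochromatic? c v) (edges H))
                            (length-filter≡∑𝟙 (nonmonochromatic? c v) (edges H))) ⟩
      ∑ (edges H) (𝟙 ∘ monochromatic? c v) + ∑ (edges H) (𝟙 ∘ nonmonochromatic? c v)
        ≡⟨ sym (∑-distrib-+ (edges H) _ _) ⟩
      ∑ (edges H) (λ e → 𝟙 (monochromatic? c v e) + 𝟙 (nonmonochromatic? c v e))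
        ≤⟨ ∑-mono-All 2-minimal (λ e 2≤∣e∣ → recolor-gain c v i 2≤∣e∣ i≢cv) ⟩
      ∑ (edges H) (λ e → 𝟙 (lonely? c e v i) + 𝟙 (nonmonochromatic? (recolor c v i) v e))
        ≡⟨ ∑-distrib-+ (edges H) _ _ ⟩
      ∑ (edges H) (λ e → 𝟙 (lonely? c e v i)) + ∑ (edges H) (𝟙 ∘ nonmonochromatic? (recolor c v i) v)
        ≡⟨ sym (cong₂ _+_ (length-filter≡∑𝟙 (λ e → lonely? c e v i) (edges H))
                           (length-filter≡∑𝟙 (nonmonochromatic? (recolor c v i) v) (edges H))) ⟩
      d1i H c v i + utility H (recolor c v i) v
        ≤⟨ +-monoʳ-≤ (d1i H c v i) (≮⇒≥ (nash v i)) ⟩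
      d1i H c v i + utility H c v
        ≡⟨ +-comm (d1i H c v i) _ ⟩
      utility H c v + d1i H c v i ∎)
    d1≥[k-1]d2 : ∀ v → (k ∸ 1) * d2 H c v ≤ d1 H c v
    d1≥[k-1]d2 v = begin
      (k ∸ 1) * d2 H c v
        ≡⟨ sym (∑-allFin-except (c v) (d2 H c v)) ⟩
      ∑ (allFin k) (λ i → if does (i ≟ c v) then 0 else d2 H c v)
        ≤⟨ ∑-mono (allFin k) (λ i → if-does-then-0-mono (i ≟ c v) (d2≤d1i v i)) ⟩
      d1 H c v ∎

lemma2 : (r k n : ℕ) → r ≥ 3 → k ≥ 2 → (H : Hypergraph n) → RMinimal r H →
    (c : Coloring n k) →
    (D1 H c + D2 H c + D3 H c + D4 H c ≡ sumDeg H c)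
    × ((r ∸ 1) * D1 H c ≤ D3 H c)
    × (NashEquilibrium H c → (k ∸ 1) * D2 H c ≤ D1 H c)
lemma2 r k n 3≤r _ H r-minimal c =
    D1+D2+D3+D4≡sumDeg H c (All.map (≤-trans 3≤r) r-minimal)
  , D3≥[r-1]D1 H c 3≤r r-minimal
  , NashEquilibrium⇒D1≥[k-1]D2 H c (All.map (≤-trans (n≤1+n 2) ∘ ≤-trans 3≤r) r-minimal)
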